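{- Let $\ell$ be a positive integer. A matroid $\mathcal{M}$ has an $\ell$-courteous coloring if and only if $\mathcal{M}$ does not contain a cut of size at most $\ell$.
   Context: A coloring of a matroid $\mathcal{M}$ with ground set $S$ is any function assigning a color from a finite set to each element of $S$. The coloring is $\ell$-courteous if, for every set of at most $\ell$ colors, deleting all elements having these colors does not change the rank of the matroid. A cut of $\mathcal{M}$ is a circuit of the dual matroid $\mathcal{M}^*$ (equivalently, an inclusion-wise minimal set whose deletion decreases the rank of $\mathcal{M}$). -}

module Defs where

open import Data.Nat using (ℕ; _≤_; _<_; _+_)
open import Data.Fin using (Fin)
open import Data.Fin.Subset using (Subset; ⊤; ∁; _∪_; _∩_; _⊆_; _⊂_; ∣_∣)
open import Data.Vec using (tabulate; lookup)
open import Data.Product using (Σ; ∃; _×_)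
open import Relation.Binary.PropositionalEquality using (_≡_)

record Matroid (n : ℕ) : Set where
  field
    rank        : Subset n → ℕ
    rank-bound  : ∀ X → rank X ≤ ∣ X ∣
    rank-mono   : ∀ X Y → X ⊆ Y → rank X ≤ rank Y
    rank-submod : ∀ X Y → rank (X ∪ Y) + rank (X ∩ Y) ≤ rank X + rank Y

open Matroid public

colored : ∀ {n k} → (Fin n → Fin k) → Subset k → Subset n
colored c T = tabulate (λ e → lookup T (c e))

IsCourteous : ∀ {n k} → ℕ → Matroid n → (Fin n → Fin k) → Set
IsCourteous ℓ M c =
  ∀ (T : Subset _) → ∣ T ∣ ≤ ℓ → rank M (∁ (colored c T)) ≡ rank M ⊤

HasCourteousColoring : ∀ {n} → ℕ → Matroid n → Set
HasCourteousColoring {n} ℓ M = Σ ℕ (λ k → Σ (Fin n → Fin k) (λ c → IsCourteous ℓ M c))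

IsCut : ∀ {n} → Matroid n → Subset n → Set
IsCut M X =
  (rank M (∁ X) < rank M ⊤) ×
  (∀ Y → Y ⊂ X → rank M (∁ Y) ≡ rank M ⊤)

HasSmallCut : ∀ {n} → ℕ → Matroid n → Set
HasSmallCut ℓ M = ∃ (λ X → IsCut M X × ∣ X ∣ ≤ ℓ)

-- A cut X of size ≤ ℓ is an obstruction to any ℓ-courteous coloring: the at most ℓ
-- colors occurring on X cover X, so deleting them lowers the rank. Conversely, if
-- there is no such cut, then deleting any set of at most ℓ elements preserves the
-- rank: a smallest set of size ≤ ℓ whose deletion lowers the rank would be a cut.
-- Hence coloring every element with its own color is ℓ-courteous.
module Submission where

open import Defs
open import Data.Nat using (ℕ; _≤_)
open import Function.Bundles using (_⇔_; mk⇔)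
open import Relation.Nullary using (¬_)

open import Data.Nat using (suc; _<_; _+_; z≤n; s≤s)
open import Data.Nat.Properties
  using (≤-trans; ≤-reflexive; <⇒≤; n≤1+n; +-suc; +-monoʳ-≤; ≤∧≢⇒<; <-irrefl; _≟_; module ≤-Reasoning)
open import Data.Nat.Induction using (<-wellFounded)
open import Induction.WellFounded using (Acc; acc)
open import Data.Fin using (Fin; zero; suc)
open import Data.Fin.Subset using (Subset; ⊤; ⊥; ∁; _∪_; _⊆_; _⊂_; ∣_∣; ⁅_⁆; inside; outside; _∈_)
open import Data.Fin.Subset.Properties
  using (⊆⊤; ∣⊥∣≡0; ∣⁅x⁆∣≡1; x∈⁅x⁆; x∈p∪q⁺; p⊂q⇒∣p∣<∣q∣; p⊆q⇒∁p⊇∁q)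
open import Data.Vec using (_∷_; []; here; there)
open import Data.Vec.Properties using (tabulate∘lookup; lookup∘tabulate; []=⇒lookup; lookup⇒[]=)
open import Data.Product using (_,_)
open import Data.Sum using (inj₁; inj₂)
open import Data.Empty using (⊥-elim)
open import Function.Base using (id; _∘_)
open import Relation.Nullary using (yes; no)
open import Relation.Binary.PropositionalEquality using (_≡_; refl; sym; trans; cong; subst)

∣p∪q∣≤∣p∣+∣q∣ : ∀ {n} (p q : Subset n) → ∣ p ∪ q ∣ ≤ ∣ p ∣ + ∣ q ∣
∣p∪q∣≤∣p∣+∣q∣ []            []            = z≤n
∣p∪q∣≤∣p∣+∣q∣ (outside ∷ p) (outside ∷ q) = ∣p∪q∣≤∣p∣+∣q∣ p q
∣p∪q∣≤∣p∣+∣q∣ (outside ∷ p) (inside  ∷ q) =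
  ≤-trans (s≤s (∣p∪q∣≤∣p∣+∣q∣ p q)) (≤-reflexive (sym (+-suc ∣ p ∣ ∣ q ∣)))
∣p∪q∣≤∣p∣+∣q∣ (inside  ∷ p) (outside ∷ q) = s≤s (∣p∪q∣≤∣p∣+∣q∣ p q)
∣p∪q∣≤∣p∣+∣q∣ (inside  ∷ p) (inside  ∷ q) =
  s≤s (≤-trans (∣p∪q∣≤∣p∣+∣q∣ p q) (+-monoʳ-≤ ∣ p ∣ (n≤1+n ∣ q ∣)))

image : ∀ {n k} → (Fin n → Fin k) → Subset n → Subset k
image c []            = ⊥
image c (inside  ∷ X) = ⁅ c zero ⁆ ∪ image (c ∘ suc) X
image c (outside ∷ X) = image (c ∘ suc) X

∣image∣≤∣p∣ : ∀ {n k} (c : Fin n → Fin k) X → ∣ image c X ∣ ≤ ∣ X ∣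
∣image∣≤∣p∣ {k = k} c [] = ≤-reflexive (∣⊥∣≡0 k)
∣image∣≤∣p∣ c (outside ∷ X) = ∣image∣≤∣p∣ (c ∘ suc) X
∣image∣≤∣p∣ c (inside ∷ X) = begin
  ∣ ⁅ c zero ⁆ ∪ image (c ∘ suc) X ∣        ≤⟨ ∣p∪q∣≤∣p∣+∣q∣ ⁅ c zero ⁆ (image (c ∘ suc) X) ⟩
  ∣ ⁅ c zero ⁆ ∣ + ∣ image (c ∘ suc) X ∣    ≡⟨ cong (_+ ∣ image (c ∘ suc) X ∣) (∣⁅x⁆∣≡1 (c zero)) ⟩
  suc ∣ image (c ∘ suc) X ∣                 ≤⟨ s≤s (∣image∣≤∣p∣ (c ∘ suc) X) ⟩
  suc ∣ X ∣                                 ∎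
  where open ≤-Reasoning

∈-image⁺ : ∀ {n k} (c : Fin n → Fin k) X {x} → x ∈ X → c x ∈ image c X
∈-image⁺ c (inside  ∷ X) here      = x∈p∪q⁺ (inj₁ (x∈⁅x⁆ (c zero)))
∈-image⁺ c (inside  ∷ X) (there x∈X) = x∈p∪q⁺ (inj₂ (∈-image⁺ (c ∘ suc) X x∈X))
∈-image⁺ c (outside ∷ X) (there x∈X) = ∈-image⁺ (c ∘ suc) X x∈X

p⊆colored-image : ∀ {n k} (c : Fin n → Fin k) X → X ⊆ colored c (image c X)
p⊆colored-image c X {x} x∈X = lookup⇒[]= x _
  (trans (lookup∘tabulate _ x) ([]=⇒lookup (∈-image⁺ c X x∈X)))

colored-id : ∀ {n} (T : Subset n) → colored id T ≡ T
colored-id = tabulate∘lookup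

module _ {n} (M : Matroid n) where

  rank≤rank⊤ : ∀ X → rank M X ≤ rank M ⊤
  rank≤rank⊤ X = rank-mono M X ⊤ ⊆⊤

  courteous⇒¬smallCut : ∀ {ℓ k} {c : Fin n → Fin k} → IsCourteous ℓ M c → ¬ HasSmallCut ℓ M
  courteous⇒¬smallCut {c = c} courteous (X , (rank-drops , _) , ∣X∣≤ℓ) = <-irrefl refl (begin-strict
    rank M ⊤                    ≡⟨ sym (courteous T (≤-trans (∣image∣≤∣p∣ c X) ∣X∣≤ℓ)) ⟩
    rank M (∁ (colored c T))    ≤⟨ rank-mono M _ _ (p⊆q⇒∁p⊇∁q (p⊆colored-image c X)) ⟩
    rank M (∁ X)                <⟨ rank-drops ⟩
    rank M ⊤                    ∎)
    where
    open ≤-Reasoning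
    T = image c X

  module _ {ℓ : ℕ} (noSmallCut : ¬ HasSmallCut ℓ M) where

    ¬smallCut⇒rank∁≡rank⊤ : ∀ Z → ∣ Z ∣ ≤ ℓ → rank M (∁ Z) ≡ rank M ⊤
    ¬smallCut⇒rank∁≡rank⊤ Z = go Z (<-wellFounded ∣ Z ∣)
      where
      go : ∀ Z → Acc _<_ ∣ Z ∣ → ∣ Z ∣ ≤ ℓ → rank M (∁ Z) ≡ rank M ⊤
      go Z (acc smaller) ∣Z∣≤ℓ with rank M (∁ Z) ≟ rank M ⊤
      ... | yes preserved = preserved
      ... | no  changed   = ⊥-elim (noSmallCut (Z , (rank-drops , minimal) , ∣Z∣≤ℓ))
        where
        rank-drops : rank M (∁ Z) < rank M ⊤
        rank-drops = ≤∧≢⇒< (rank≤rank⊤ (∁ Z)) changed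

        minimal : ∀ Y → Y ⊂ Z → rank M (∁ Y) ≡ rank M ⊤
        minimal Y Y⊂Z = go Y (smaller ∣Y∣<∣Z∣) (≤-trans (<⇒≤ ∣Y∣<∣Z∣) ∣Z∣≤ℓ)
          where ∣Y∣<∣Z∣ = p⊂q⇒∣p∣<∣q∣ Y⊂Z

    ¬smallCut⇒courteous-id : IsCourteous ℓ M id
    ¬smallCut⇒courteous-id T ∣T∣≤ℓ =
      subst (λ Z → rank M (∁ Z) ≡ rank M ⊤) (sym (colored-id T)) (¬smallCut⇒rank∁≡rank⊤ T ∣T∣≤ℓ)

proposition3p3 : (ℓ : ℕ) → 1 ≤ ℓ → ∀ {n} (M : Matroid n) →
    HasCourteousColoring ℓ M ⇔ (¬ HasSmallCut ℓ M)
proposition3p3 ℓ _ {n} M = mk⇔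
  (λ (_ , _ , courteous) → courteous⇒¬smallCut M courteous)
  (λ noSmallCut → n , id , ¬smallCut⇒courteous-id M noSmallCut)
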